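{- For every graph $G$, $\mathrm{nd}(G)<2^{2\max\rho(G)+2}$.
   Context: Graphs are finite and simple. $\rho_G(X)$ is the binary rank of the $X\times(V(G)\setminus X)$ adjacency submatrix and $\max\rho(G)=\max_{S\subseteq V(G)}\rho_G(S)$. Distinct vertices $x,y$ are twins if $N(x)\setminus\{x,y\}=N(y)\setminus\{x,y\}$; $\mathrm{nd}(G)$ is the number of classes of the equivalence relation $x\sim y$ iff $x=y$ or $x,y$ are twins. -}

module Defs where

open import Data.Nat using (ℕ; zero; suc; _≤_; _<_)
open import Data.Fin using (Fin; zero; suc; _≟_; _<?_)
open import Data.Bool using (Bool; true; false; _∧_; _∨_; not; _xor_; if_then_else_)
open import Data.Bool.Properties using () renaming (_≟_ to _≟ᵇ_)
open import Data.Vec using (lookup)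
open import Data.Fin.Subset using (Subset; _∈_; _∉_)
open import Data.List using (List; filter; length)
open import Data.Bool.ListAction using (all; any)
open import Data.List using () renaming (allFin to allFinL)
open import Data.Product using (Σ; ∃; _×_; _,_)
open import Relation.Nullary using (¬_; does)
open import Relation.Binary.PropositionalEquality using (_≡_; _≢_)

record Graph (n : ℕ) : Set where
  field
    adj   : Fin n → Fin n → Bool
    sym   : ∀ x y → adj x y ≡ adj y x
    irref : ∀ x → adj x x ≡ false
open Graph public

-- Vectors over GF(2) indexed by the vertices (Bool with xor as addition).
-- The row of vertex x in the X × (V∖X) adjacency submatrix, with the
-- coordinates in X set to 0 (Subset n = Vec Bool n; lookup X z = true iff z ∈ X) (they are not columns of the submatrix).
row : ∀ {n} → Graph n → Subset n → Fin n → Fin n → Bool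
row G X x z = adj G x z ∧ not (lookup X z)

lincomb : ∀ {k n} → (Fin k → Bool) → (Fin k → Fin n → Bool) → Fin n → Bool
lincomb {zero}  c v z = false
lincomb {suc k} c v z = (c zero ∧ v zero z) xor lincomb (λ i → c (suc i)) (λ i → v (suc i)) z

LinIndep : ∀ {k n} → (Fin k → Fin n → Bool) → Set
LinIndep {k} {n} v =
  ∀ (c : Fin k → Bool) → (∃ λ i → c i ≡ true) → ∃ λ z → lincomb c v z ≡ true

IndepRows : ∀ {n} → Graph n → Subset n → (k : ℕ) → Set
IndepRows {n} G X k =
  Σ (Fin k → Fin n) λ f → (∀ i → f i ∈ X) × LinIndep (λ i → row G X (f i))

RhoIs : ∀ {n} → Graph n → Subset n → ℕ → Set
RhoIs G X r = IndepRows G X r × (∀ k → IndepRows G X k → k ≤ r)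

MaxRhoIs : ∀ {n} → Graph n → ℕ → Set
MaxRhoIs {n} G m =
  (∃ λ (S : Subset n) → RhoIs G S m) × (∀ (S : Subset n) r → RhoIs G S r → r ≤ m)

twinsB : ∀ {n} → Graph n → Fin n → Fin n → Bool
twinsB {n} G x y =
  not (does (x ≟ y)) ∧
  all (λ z → does (z ≟ x) ∨ does (z ≟ y) ∨ does (adj G x z ≟ᵇ adj G y z)) (allFinL n)

equivB : ∀ {n} → Graph n → Fin n → Fin n → Bool
equivB G x y = does (x ≟ y) ∨ twinsB G x y

isRepB : ∀ {n} → Graph n → Fin n → Bool
isRepB {n} G x = not (any (λ y → does (y <? x) ∧ equivB G y x) (allFinL n))

-- nd(G): number of equivalence classes = number of class-minimal vertices.
nd : ∀ {n} → Graph n → ℕ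
nd {n} G = length (filter (λ x → isRepB G x ≟ᵇ true) (allFinL n))

-- Let m = max ρ(G) and suppose nd(G) ≥ 4^(m+1). The least vertices of the twin classes are
-- pairwise distinguishable: any two are told apart by a third vertex. In such a family P pick a
-- vertex z distinguishing two members u, v, keep the majority side of P ∖ {z} with respect to
-- adjacency to z, take the one of u, v on the other side as a column c, and keep the majority side
-- of the survivors with respect to adjacency to c. A round costs a factor 4, so m + 1 rounds give
-- pivots z_r, columns c_s and a last survivor w such that z_s separates c_s from w while z_r does
-- not for r < s. On the columns outside X = {z_r} the rows of the pivots are thus triangular,
-- hence independent over GF(2), and ρ(X) ≥ m + 1.

module Submission where

open import Defs hiding (sym)
open import Data.Nat using (ℕ; zero; suc; _+_; _*_; _^_; _≤_; _<_; z≤n; s≤s; s≤s⁻¹)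
import Data.Nat as ℕ
open import Data.Nat.Properties
  using (≤-trans; ≤-reflexive; +-suc; +-monoʳ-≤; +-monoˡ-≤; *-monoʳ-≤; *-suc; *-assoc; *-cancelˡ-<;
         ^-*-assoc; m^n>0; m≤m+n; ≮⇒≥; ≤⇒≯; +-identityʳ; ≤-total; +-comm)
open import Data.Fin as Fin using (Fin; zero; suc; _≟_; _<?_)
open import Data.Fin.Properties using (any?; injective⇒≤; <⇒≢)
open import Data.Fin.Subset using (Subset) renaming (_∈_ to _∈ₛ_)
open import Data.Vec as Vec using (lookup)
open import Data.Vec.Properties using (lookup∘tabulate; lookup⇒[]=)
open import Data.Bool using (Bool; true; false; T; _∧_; _∨_; not; _xor_)
open import Data.Bool.Properties
  using (T-≡; T-not-≡; T-∧; T-∨; ¬-not; xor-identityʳ; xor-same; ∧-distribʳ-xor; ∧-identityʳ;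
         xor-∧-commutativeRing)
  renaming (_≟_ to _≟ᵇ_)
open import Data.List using (List; []; _∷_; length; filter; allFin)
open import Data.List.Properties using (filter-all)
open import Data.List.Membership.Propositional using (_∈_; lose)
open import Data.List.Membership.Propositional.Properties using (∈-filter⁻; ∈-allFin)
open import Data.List.Relation.Binary.Subset.Propositional using (_⊆_)
open import Data.List.Relation.Unary.All as All using (All; []; _∷_)
open import Data.List.Relation.Unary.All.Properties using (all-filter; all⁻; ¬All⇒Any¬)
open import Data.List.Relation.Unary.Any using (here; there; satisfied)
open import Data.List.Relation.Unary.Any.Properties using (any⁺)
open import Data.List.Relation.Unary.AllPairs as AllPairs using (AllPairs; []; _∷_)
open import Data.List.Relation.Unary.AllPairs.Properties using (filter⁺; tabulate⁺-<)
open import Data.List.Relation.Unary.Unique.Propositional using (Unique)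
open import Data.Product using (∃; ∃₂; _×_; _,_; proj₁; proj₂)
open import Data.Sum using (_⊎_; inj₁; inj₂; [_,_]′)
open import Data.Empty using (⊥-elim)
open import Function using (_∘_; Equivalence)
open import Relation.Nullary using (¬_; Dec; yes; no; does; ¬?; contradiction)
open import Relation.Nullary.Decidable using (dec-true; dec-false; T?; ¬¬-excluded-middle)
open import Relation.Unary using (Decidable)
open import Relation.Binary using (DecidableEquality)
open import Relation.Binary.PropositionalEquality
  using (_≡_; _≢_; refl; sym; trans; cong; cong₂; subst; ≢-sym; module ≡-Reasoning)
open import Algebra using (CommutativeRing)
open import Algebra.Properties.CommutativeSemigroup
  (CommutativeRing.+-commutativeSemigroup xor-∧-commutativeRing) using (interchange)
open import Algebra.Properties.Group (CommutativeRing.+-group xor-∧-commutativeRing)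
  using (∙-cancelˡ)

open Equivalence using (from)

T-does : ∀ {A : Set} (a? : Dec A) → A → T (does a?)
T-does a? a = from T-≡ (dec-true a? a)

T-not-does : ∀ {A : Set} (a? : Dec A) → ¬ A → T (not (does a?))
T-not-does a? ¬a = from T-not-≡ (dec-false a? ¬a)

¬T-∨ : ∀ {a b} → ¬ T (a ∨ b) → ¬ T a × ¬ T b
¬T-∨ {a} ¬a∨b = ¬a∨b ∘ from (T-∨ {a}) ∘ inj₁ , ¬a∨b ∘ from (T-∨ {a}) ∘ inj₂

T-not⇒¬T : ∀ {b} → T (not b) → ¬ T b
T-not⇒¬T {false} _ ()

≢⇒either-true : ∀ {x y : Bool} → x ≢ y → x ≡ true ⊎ y ≡ true
≢⇒either-true {true}          _   = inj₁ refl
≢⇒either-true {false} {true}  _   = inj₂ refl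
≢⇒either-true {false} {false} x≢y = contradiction refl x≢y

≢-both⇒≡ : ∀ {x y z : Bool} → x ≢ z → y ≢ z → x ≡ y
≢-both⇒≡ x≢z y≢z = trans (¬-not x≢z) (sym (¬-not y≢z))

2^[2m+2]≡4^[1+m] : ∀ m → 2 ^ (2 * m + 2) ≡ 4 ^ suc m
2^[2m+2]≡4^[1+m] m = begin
  2 ^ (2 * m + 2)  ≡⟨ cong (2 ^_) (trans (+-comm (2 * m) 2) (sym (*-suc 2 m))) ⟩
  2 ^ (2 * suc m)  ≡⟨ sym (^-*-assoc 2 2 (suc m)) ⟩
  4 ^ suc m        ∎
  where open ≡-Reasoning

4≤4^[1+t] : ∀ t → 4 ≤ 4 ^ suc t
4≤4^[1+t] t = *-monoʳ-≤ 4 (m^n>0 4 t)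

quarter-≤ : ∀ {a b} → 4 * a ≤ suc (4 * b) → a ≤ b
quarter-≤ {a} {b} h = s≤s⁻¹ (*-cancelˡ-< 4 a (suc b) (begin-strict
  4 * a         ≤⟨ h ⟩
  suc (4 * b)   <⟨ +-monoˡ-≤ (4 * b) {2} {4} (s≤s (s≤s z≤n)) ⟩
  4 + 4 * b     ≡⟨ sym (*-suc 4 b) ⟩
  4 * suc b     ∎))
  where open Data.Nat.Properties.≤-Reasoning

m+m≡2*m : ∀ m → m + m ≡ 2 * m
m+m≡2*m m = cong (m +_) (sym (+-identityʳ m))

larger-half : ∀ a b → a + b ≤ 2 * a ⊎ a + b ≤ 2 * b
larger-half a b with ≤-total a b
... | inj₁ a≤b = inj₂ (≤-trans (+-monoˡ-≤ b a≤b) (≤-reflexive (m+m≡2*m b)))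
... | inj₂ b≤a = inj₁ (≤-trans (+-monoʳ-≤ a b≤a) (≤-reflexive (m+m≡2*m a)))

module _ {A : Set} where

  length-filter-true+false : (f : A → Bool) (xs : List A) →
    length (filter (λ x → f x ≟ᵇ true) xs) + length (filter (λ x → f x ≟ᵇ false) xs) ≡ length xs
  length-filter-true+false f []       = refl
  length-filter-true+false f (x ∷ xs) with f x
  ... | true  = cong suc (length-filter-true+false f xs)
  ... | false = trans (+-suc _ _) (cong suc (length-filter-true+false f xs))

  majority : (f : A → Bool) (xs : List A) →
             ∃ λ b → length xs ≤ 2 * length (filter (λ x → f x ≟ᵇ b) xs)
  majority f xs =
    [ (true ,_) , (false ,_) ]′
      (subst (λ l → l ≤ 2 * count true ⊎ l ≤ 2 * count false)
             (length-filter-true+false f xs) (larger-half (count true) (count false)))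
    where
    count : Bool → ℕ
    count b = length (filter (λ x → f x ≟ᵇ b) xs)

  length-filter-≢ : (_≟ₐ_ : DecidableEquality A) {z : A} {xs : List A} → Unique xs →
                    length xs ≤ suc (length (filter (λ x → ¬? (x ≟ₐ z)) xs))
  length-filter-≢ _≟ₐ_ {z} {[]}     []           = z≤n
  length-filter-≢ _≟ₐ_ {z} {x ∷ xs} (x∉xs ∷ xs!) with x ≟ₐ z
  ... | yes refl =
    s≤s (≤-reflexive (sym (cong length (filter-all (λ y → ¬? (y ≟ₐ x)) (All.map ≢-sym x∉xs)))))
  ... | no  _    = s≤s (length-filter-≢ _≟ₐ_ xs!)

module _ {A : Set} {P : A → Set} {R : A → A → Set} (P? : Decidable P) where

  filter⁺-discharge : ∀ {xs} → AllPairs (λ x y → P y → R x y) xs → AllPairs R (filter P? xs)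
  filter⁺-discharge {xs} pairs = discharge (all-filter P? xs) (filter⁺ P? pairs)
    where
    discharge : ∀ {ys} → All P ys → AllPairs (λ x y → P y → R x y) ys → AllPairs R ys
    discharge []         []           = []
    discharge (_ ∷ Pys) (Rx ∷ Rys) = All.zipWith (λ (r , p) → r p) (Rx , Pys) ∷ discharge Pys Rys

-- Constructively a maximum of a bounded predicate on ℕ exists only up to double negation.
¬¬-maximum : ∀ {Q : ℕ → Set} {b j} → (∀ k → Q k → k ≤ b) → Q j →
             ¬ ¬ ∃ λ r → Q r × (∀ k → Q k → k ≤ r)
¬¬-maximum {Q} {b} {j} bounded = search b (m≤m+n b j)
  where
  search : ∀ d {j} → b ≤ d + j → Q j → ¬ ¬ ∃ λ r → Q r × (∀ k → Q k → k ≤ r)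
  search zero    {j} b≤j Qj ¬max = ¬max (j , Qj , λ k Qk → ≤-trans (bounded k Qk) b≤j)
  search (suc d) {j} b≤d+j Qj ¬max = ¬¬-excluded-middle {A = ∃ λ k → j < k × Q k} λ
    { (yes (k , j<k , Qk)) →
        search d (≤-trans b≤d+j (subst (_≤ d + k) (+-suc d j) (+-monoʳ-≤ d j<k))) Qk ¬max
    ; (no ∄larger) → ¬max (j , Qj , λ k Qk → ≮⇒≥ λ j<k → ∄larger (k , j<k , Qk)) }

-- Linear algebra over GF(2)

module _ {n : ℕ} where

  lincomb-zero : ∀ {k} (c : Fin k → Bool) (v : Fin k → Fin n → Bool) z →
                 (∀ i → c i ≡ false) → lincomb c v z ≡ false
  lincomb-zero {zero}  c v z c≡0 = refl
  lincomb-zero {suc k} c v z c≡0 rewrite c≡0 zero = lincomb-zero (c ∘ suc) (v ∘ suc) z (c≡0 ∘ suc)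

  lincomb-xor : ∀ {k} (a b : Fin k → Bool) (v : Fin k → Fin n → Bool) z →
                lincomb (λ i → a i xor b i) v z ≡ lincomb a v z xor lincomb b v z
  lincomb-xor {zero}  a b v z = refl
  lincomb-xor {suc k} a b v z = begin
    ((a₀ xor b₀) ∧ v₀) xor lincomb (λ i → a (suc i) xor b (suc i)) (v ∘ suc) z
      ≡⟨ cong₂ _xor_ (∧-distribʳ-xor v₀ a₀ b₀) (lincomb-xor (a ∘ suc) (b ∘ suc) (v ∘ suc) z) ⟩
    ((a₀ ∧ v₀) xor (b₀ ∧ v₀)) xor (rest-a xor rest-b)
      ≡⟨ interchange (a₀ ∧ v₀) (b₀ ∧ v₀) rest-a rest-b ⟩
    ((a₀ ∧ v₀) xor rest-a) xor ((b₀ ∧ v₀) xor rest-b)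
      ∎
    where
    open ≡-Reasoning
    a₀ b₀ v₀ rest-a rest-b : Bool
    a₀ = a zero
    b₀ = b zero
    v₀ = v zero z
    rest-a = lincomb (a ∘ suc) (v ∘ suc) z
    rest-b = lincomb (b ∘ suc) (v ∘ suc) z

  indicator : ∀ {k} → Fin k → Fin k → Bool
  indicator i l = does (l ≟ i)

  lincomb-indicator : ∀ {k} (v : Fin k → Fin n → Bool) i z → lincomb (indicator i) v z ≡ v i z
  lincomb-indicator v zero    z =
    trans (cong (v zero z xor_) (lincomb-zero _ (v ∘ suc) z λ _ → refl)) (xor-identityʳ _)
  lincomb-indicator v (suc i) z = lincomb-indicator (v ∘ suc) i z

  LinIndep⇒injective : ∀ {k} {v : Fin k → Fin n → Bool} → LinIndep v →
                       ∀ {i j} → (∀ z → v i z ≡ v j z) → i ≡ j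
  LinIndep⇒injective {v = v} indep {i} {j} vᵢ≗vⱼ with i ≟ j
  ... | yes i≡j = i≡j
  ... | no  i≢j =
    let z , nonzero = indep c (i , cᵢ) in contradiction (trans (sym nonzero) (vanishes z)) λ ()
    where
    c : Fin _ → Bool
    c l = indicator i l xor indicator j l
    cᵢ : c i ≡ true
    cᵢ rewrite dec-true (i ≟ i) refl | dec-false (i ≟ j) i≢j = refl
    vanishes : ∀ z → lincomb c v z ≡ false
    vanishes z = begin
      lincomb c v z
        ≡⟨ lincomb-xor (indicator i) (indicator j) v z ⟩
      lincomb (indicator i) v z xor lincomb (indicator j) v z
        ≡⟨ cong₂ _xor_ (lincomb-indicator v i z) (lincomb-indicator v j z) ⟩
      v i z xor v j z
        ≡⟨ cong (_xor v j z) (vᵢ≗vⱼ z) ⟩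
      v j z xor v j z
        ≡⟨ xor-same (v j z) ⟩
      false
        ∎
      where open ≡-Reasoning

  triangular-lincomb : ∀ {k} (v : Fin k → Fin n → Bool) (col : Fin k → Fin n) (ref : Fin n) →
    (∀ s → v s (col s) ≢ v s ref) → (∀ {r s} → r Fin.< s → v r (col s) ≡ v r ref) →
    ∀ c → (∀ i → c i ≡ false) ⊎ ∃ λ s → lincomb c v (col s) ≢ lincomb c v ref
  triangular-lincomb {zero}  v col ref differs agrees c = inj₁ λ ()
  triangular-lincomb {suc k} v col ref differs agrees c
    with triangular-lincomb (v ∘ suc) (col ∘ suc) ref (differs ∘ suc) (agrees ∘ ℕ.s<s) (c ∘ suc)
  ... | inj₂ (s , tail-differs) = inj₂ (suc s , tail-differs ∘ cancel-head)
    where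
    tail : Fin _ → Bool
    tail = lincomb (c ∘ suc) (v ∘ suc)
    cancel-head : lincomb c v (col (suc s)) ≡ lincomb c v ref → tail (col (suc s)) ≡ tail ref
    cancel-head eq = ∙-cancelˡ (c zero ∧ v zero ref) (tail (col (suc s))) (tail ref)
      (trans (cong (λ b → (c zero ∧ b) xor tail (col (suc s))) (sym (agrees ℕ.z<s))) eq)
  ... | inj₁ tail-zero with c zero in c₀
  ...   | false = inj₁ λ { zero → c₀ ; (suc i) → tail-zero i }
  ...   | true  =
    inj₂ (zero , λ eq → differs zero (trans (sym (head-only (col zero))) (trans eq (head-only ref))))
    where
    head-only : ∀ z → v zero z xor lincomb (c ∘ suc) (v ∘ suc) z ≡ v zero z
    head-only z = trans (cong (v zero z xor_) (lincomb-zero (c ∘ suc) (v ∘ suc) z tail-zero)) (xor-identityʳ _)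

  triangular⇒LinIndep : ∀ {k} (v : Fin k → Fin n → Bool) (col : Fin k → Fin n) (ref : Fin n) →
    (∀ s → v s (col s) ≢ v s ref) → (∀ {r s} → r Fin.< s → v r (col s) ≡ v r ref) → LinIndep v
  triangular⇒LinIndep v col ref differs agrees c (i , cᵢ)
    with triangular-lincomb v col ref differs agrees c
  ... | inj₁ c≡0       = contradiction (trans (sym cᵢ) (c≡0 i)) λ ()
  ... | inj₂ (s , c≢r) with ≢⇒either-true c≢r
  ...   | inj₁ at-col = col s , at-col
  ...   | inj₂ at-ref = ref , at-ref

image : ∀ {k n} → (Fin k → Fin n) → Subset n
image f = Vec.tabulate λ y → does (any? λ r → f r ≟ y)

∈-image : ∀ {k n} (f : Fin k → Fin n) r → f r ∈ₛ image f
∈-image f r = lookup⇒[]= (f r) (image f) (trans (lookup∘tabulate _ (f r)) (dec-true (any? _) (r , refl)))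

∉-image : ∀ {k n} {f : Fin k → Fin n} {y} → (∀ r → f r ≢ y) → lookup (image f) y ≡ false
∉-image {f = f} {y} f≢y = trans (lookup∘tabulate _ y) (dec-false (any? _) λ (r , fr≡y) → f≢y r fr≡y)

module _ {n : ℕ} (G : Graph n) where

  row-outside : ∀ {X x y} → lookup X y ≡ false → row G X x y ≡ adj G x y
  row-outside {x = x} {y} y∉X rewrite y∉X = ∧-identityʳ (adj G x y)

  IndepRows⇒≤ : ∀ X k → IndepRows G X k → k ≤ n
  IndepRows⇒≤ X k (f , _ , indep) =
    injective⇒≤ λ fᵢ≡fⱼ → LinIndep⇒injective indep λ z → cong (λ x → row G X x z) fᵢ≡fⱼ

  -- Twin classes

  Distinguishable : Fin n → Fin n → Set
  Distinguishable x y = ∃ λ z → z ≢ x × z ≢ y × adj G x z ≢ adj G y z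

  distinguishable⇒≢ : ∀ {x y} → Distinguishable x y → x ≢ y
  distinguishable⇒≢ (_ , _ , _ , xz≢yz) refl = xz≢yz refl

  ¬twins⇒distinguishable : ∀ {x y} → x ≢ y → ¬ T (twinsB G x y) → Distinguishable x y
  ¬twins⇒distinguishable {x} {y} x≢y ¬twins =
    distinguisher (satisfied (¬All⇒Any¬ (T? ∘ agree) (allFin n) λ all-agree →
      ¬twins (from T-∧ (T-not-does (x ≟ y) x≢y , all⁻ agree all-agree))))
    where
    agree : Fin n → Bool
    agree z = does (z ≟ x) ∨ does (z ≟ y) ∨ does (adj G x z ≟ᵇ adj G y z)
    distinguisher : (∃ λ z → ¬ T (agree z)) → Distinguishable x y
    distinguisher (z , ¬agree) =
      let ¬z≡x , ¬rest   = ¬T-∨ ¬agree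
          ¬z≡y , ¬xz≡yz  = ¬T-∨ ¬rest
      in z , ¬z≡x ∘ T-does (z ≟ x) , ¬z≡y ∘ T-does (z ≟ y) , ¬xz≡yz ∘ T-does (adj G x z ≟ᵇ adj G y z)

  rep⇒distinguishable : ∀ {x y} → x Fin.< y → isRepB G y ≡ true → Distinguishable x y
  rep⇒distinguishable {x} {y} x<y y-rep = ¬twins⇒distinguishable (<⇒≢ x<y) λ twins →
    T-not⇒¬T (from T-≡ y-rep)
      (any⁺ _ (lose (∈-allFin x) (from T-∧ (T-does (x <? y) x<y , from (T-∨ {does (x ≟ y)}) (inj₂ twins)))))

  representatives : List (Fin n)
  representatives = filter (λ x → isRepB G x ≟ᵇ true) (allFin n)

  representatives-distinguishable : AllPairs Distinguishable representatives
  representatives-distinguishable =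
    filter⁺-discharge (λ x → isRepB G x ≟ᵇ true) (tabulate⁺-< rep⇒distinguishable)

  -- Staircases

  Splits : Fin n → List (Fin n) → Set
  Splits z P = ∃₂ λ a b → a ∈ P × b ∈ P × adj G z a ≢ adj G z b

  record Staircase (t : ℕ) (P : List (Fin n)) : Set where
    field
      pivot         : Fin t → Fin n
      col           : Fin t → Fin n
      ref           : Fin n
      pivot-differs : ∀ s → adj G (pivot s) (col s) ≢ adj G (pivot s) ref
      pivot-agrees  : ∀ {r s} → r Fin.< s → adj G (pivot r) (col s) ≡ adj G (pivot r) ref
      pivot≢col     : ∀ r s → pivot r ≢ col s
      pivot≢ref     : ∀ r → pivot r ≢ ref
      col∈          : ∀ s → col s ∈ P
      ref∈          : ref ∈ P
      pivot-splits  : ∀ r → Splits (pivot r) P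

  staircase⇒IndepRows : ∀ {t P} (S : Staircase t P) → IndepRows G (image (Staircase.pivot S)) t
  staircase⇒IndepRows S = pivot , ∈-image pivot , triangular⇒LinIndep v col ref differs agrees
    where
    open Staircase S
    v : Fin _ → Fin n → Bool
    v r = row G (image pivot) (pivot r)
    at-col : ∀ r s → v r (col s) ≡ adj G (pivot r) (col s)
    at-col r s = row-outside {image pivot} (∉-image λ r′ → pivot≢col r′ s)
    at-ref : ∀ r → v r ref ≡ adj G (pivot r) ref
    at-ref r = row-outside {image pivot} (∉-image pivot≢ref)
    differs : ∀ s → v s (col s) ≢ v s ref
    differs s eq = pivot-differs s (trans (sym (at-col s s)) (trans eq (at-ref s)))
    agrees : ∀ {r s} → r Fin.< s → v r (col s) ≡ v r ref
    agrees {r} {s} r<s = trans (at-col r s) (trans (pivot-agrees r<s) (sym (at-ref r)))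

  -- Halving also by adjacency to col keeps every later pivot, which splits two survivors, off col.
  record Refinement (P : List (Fin n)) : Set where
    field
      pivot           : Fin n
      col             : Fin n
      survivors       : List (Fin n)
      survivors⊆      : survivors ⊆ P
      col∈            : col ∈ P
      pivot-splits    : Splits pivot P
      pivot≢col       : pivot ≢ col
      pivot≢survivor  : ∀ {q} → q ∈ survivors → pivot ≢ q
      pivot-separates : ∀ {q} → q ∈ survivors → adj G pivot q ≢ adj G pivot col
      col-constant    : ∀ {q q′} → q ∈ survivors → q′ ∈ survivors → adj G col q ≡ adj G col q′
      survivors-distinguishable : AllPairs Distinguishable survivors
      length-survivors : length P ≤ suc (4 * length survivors)

  refine : ∀ {u v rest} → AllPairs Distinguishable (u ∷ v ∷ rest) → Refinement (u ∷ v ∷ rest)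
  refine {u} {v} {rest} distinct@(((z , z≢u , z≢v , uz≢vz) ∷ _) ∷ _) = record
    { pivot           = z
    ; col             = c
    ; survivors       = Q
    ; survivors⊆      = P₁⊆P ∘ P₂⊆P₁ ∘ Q⊆P₂
    ; col∈            = c∈P
    ; pivot-splits    = u , v , here refl , there (here refl) , zu≢zv
    ; pivot≢col       = z≢c
    ; pivot≢survivor  = λ q∈Q z≡q → off-pivot (P₂⊆P₁ (Q⊆P₂ q∈Q)) (sym z≡q)
    ; pivot-separates = λ q∈Q zq≡zc → zc≢b₁ (trans (sym zq≡zc) (on-side₁ (Q⊆P₂ q∈Q)))
    ; col-constant    = λ q∈Q q′∈Q → trans (on-side₂ q∈Q) (sym (on-side₂ q′∈Q))
    ; survivors-distinguishable = filter⁺ on-side₂? (filter⁺ on-side₁? (filter⁺ off-pivot? distinct))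
    ; length-survivors = begin
        length P                   ≤⟨ length-filter-≢ _≟_ (AllPairs.map distinguishable⇒≢ distinct) ⟩
        suc (length P₁)            ≤⟨ s≤s (proj₂ (majority (adj G z) P₁)) ⟩
        suc (2 * length P₂)        ≤⟨ s≤s (*-monoʳ-≤ 2 (proj₂ (majority (adj G c) P₂))) ⟩
        suc (2 * (2 * length Q))   ≡⟨ cong suc (sym (*-assoc 2 2 (length Q))) ⟩
        suc (4 * length Q)         ∎
    }
    where
    open Data.Nat.Properties.≤-Reasoning
    P : List (Fin n)
    P = u ∷ v ∷ rest
    zu≢zv : adj G z u ≢ adj G z v
    zu≢zv e = uz≢vz (trans (Graph.sym G u z) (trans e (Graph.sym G z v)))

    off-pivot? : Decidable (_≢ z)
    off-pivot? p = ¬? (p ≟ z)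
    P₁ : List (Fin n)
    P₁ = filter off-pivot? P
    P₁⊆P : P₁ ⊆ P
    P₁⊆P = proj₁ ∘ ∈-filter⁻ off-pivot? {xs = P}
    off-pivot : ∀ {q} → q ∈ P₁ → q ≢ z
    off-pivot = proj₂ ∘ ∈-filter⁻ off-pivot? {xs = P}

    b₁ : Bool
    b₁ = proj₁ (majority (adj G z) P₁)
    on-side₁? : Decidable λ p → adj G z p ≡ b₁
    on-side₁? p = adj G z p ≟ᵇ b₁
    P₂ : List (Fin n)
    P₂ = filter on-side₁? P₁
    P₂⊆P₁ : P₂ ⊆ P₁
    P₂⊆P₁ = proj₁ ∘ ∈-filter⁻ on-side₁? {xs = P₁}
    on-side₁ : ∀ {q} → q ∈ P₂ → adj G z q ≡ b₁
    on-side₁ = proj₂ ∘ ∈-filter⁻ on-side₁? {xs = P₁}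

    column : ∃ λ c → c ∈ P × z ≢ c × adj G z c ≢ b₁
    column with adj G z u ≟ᵇ b₁
    ... | no  zu≢b₁ = u , here refl , z≢u , zu≢b₁
    ... | yes zu≡b₁ = v , there (here refl) , z≢v , λ zv≡b₁ → zu≢zv (trans zu≡b₁ (sym zv≡b₁))
    c : Fin n
    c = proj₁ column
    c∈P : c ∈ P
    c∈P = proj₁ (proj₂ column)
    z≢c : z ≢ c
    z≢c = proj₁ (proj₂ (proj₂ column))
    zc≢b₁ : adj G z c ≢ b₁
    zc≢b₁ = proj₂ (proj₂ (proj₂ column))

    b₂ : Bool
    b₂ = proj₁ (majority (adj G c) P₂)
    on-side₂? : Decidable λ p → adj G c p ≡ b₂
    on-side₂? p = adj G c p ≟ᵇ b₂
    Q : List (Fin n)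
    Q = filter on-side₂? P₂
    Q⊆P₂ : Q ⊆ P₂
    Q⊆P₂ = proj₁ ∘ ∈-filter⁻ on-side₂? {xs = P₂}
    on-side₂ : ∀ {q} → q ∈ Q → adj G c q ≡ b₂
    on-side₂ = proj₂ ∘ ∈-filter⁻ on-side₂? {xs = P₂}

  extend : ∀ {t P} (R : Refinement P) → Staircase t (Refinement.survivors R) → Staircase (suc t) P
  extend R S = record
    { pivot         = λ { zero → R.pivot ; (suc r) → S.pivot r }
    ; col           = λ { zero → R.col   ; (suc s) → S.col s }
    ; ref           = S.ref
    ; pivot-differs = λ { zero → ≢-sym (R.pivot-separates S.ref∈) ; (suc s) → S.pivot-differs s }
    ; pivot-agrees  = λ { {zero} {suc s} _ → ≢-both⇒≡ (R.pivot-separates (S.col∈ s)) (R.pivot-separates S.ref∈)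
                        ; {suc r} {suc s} (ℕ.s<s r<s) → S.pivot-agrees r<s }
    ; pivot≢col     = λ { zero zero → R.pivot≢col
                        ; zero (suc s) → R.pivot≢survivor (S.col∈ s)
                        ; (suc r) zero → splits⇒≢col (S.pivot-splits r)
                        ; (suc r) (suc s) → S.pivot≢col r s }
    ; pivot≢ref     = λ { zero → R.pivot≢survivor S.ref∈ ; (suc r) → S.pivot≢ref r }
    ; col∈          = λ { zero → R.col∈ ; (suc s) → R.survivors⊆ (S.col∈ s) }
    ; ref∈          = R.survivors⊆ S.ref∈
    ; pivot-splits  = λ { zero → R.pivot-splits ; (suc r) → lift-splits (S.pivot-splits r) }
    }
    where
    module R = Refinement R
    module S = Staircase S
    splits⇒≢col : ∀ {y} → Splits y R.survivors → y ≢ R.col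
    splits⇒≢col (a , b , a∈ , b∈ , ya≢yb) refl = ya≢yb (R.col-constant a∈ b∈)
    lift-splits : ∀ {y} → Splits y R.survivors → Splits y _
    lift-splits (a , b , a∈ , b∈ , ya≢yb) = a , b , R.survivors⊆ a∈ , R.survivors⊆ b∈ , ya≢yb

  staircase : ∀ t {P} → AllPairs Distinguishable P → 4 ^ t ≤ length P → Staircase t P
  staircase zero    {[]}    _ ()
  staircase zero    {x ∷ _} _ _ = record
    { pivot = λ () ; col = λ () ; ref = x
    ; pivot-differs = λ () ; pivot-agrees = λ { {()} } ; pivot≢col = λ () ; pivot≢ref = λ ()
    ; col∈ = λ () ; ref∈ = here refl ; pivot-splits = λ () }
  staircase (suc t) {[]}        _ large = contradiction (≤-trans (4≤4^[1+t] t) large) λ ()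
  staircase (suc t) {_ ∷ []}    _ large = contradiction (≤-trans (4≤4^[1+t] t) large) λ { (s≤s ()) }
  staircase (suc t) {_ ∷ _ ∷ _} distinct large =
    extend R (staircase t R.survivors-distinguishable (quarter-≤ (≤-trans large R.length-survivors)))
    where
    R : Refinement _
    R = refine distinct
    module R = Refinement R

lemma5p3 : ∀ (n : ℕ) (G : Graph n) (m : ℕ) → MaxRhoIs G m → nd G < 2 ^ (2 * m + 2)
lemma5p3 n G m (_ , maximal) with nd G ℕ.<? 2 ^ (2 * m + 2)
... | yes few = few
... | no  ¬few = ⊥-elim (¬¬-maximum (IndepRows⇒≤ G X) indep no-maximum)
  where
  many : 4 ^ suc m ≤ length (representatives G)
  many = subst (_≤ nd G) (2^[2m+2]≡4^[1+m] m) (≮⇒≥ ¬few)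
  S : Staircase G (suc m) (representatives G)
  S = staircase G (suc m) (representatives-distinguishable G) many
  X : Subset n
  X = image (Staircase.pivot S)
  indep : IndepRows G X (suc m)
  indep = staircase⇒IndepRows G S
  no-maximum : ¬ ∃ (RhoIs G X)
  no-maximum (r , ρ) = ≤⇒≯ (maximal X r ρ) (proj₂ ρ (suc m) indep)
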